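{- Let $k_E$ be a field, $d\ge1$, $\Delta\ge0$. Let $M_1=M_2M_3M_4$ with $M_1\in\mathrm{Mat}_d(k_E[[u]])$ upper triangular with diagonal $[c_1u^{t_1},\dots,c_du^{t_d}]$ ($t_x\ge0$, $c_x\in k_E[[u]]^\times$), $M_2\in\mathrm{Mat}_d(k_E[[u]])$, $M_3=[u^{r_1},\dots,u^{r_d}]$ with $0\le r_1\le\dots\le r_d\le\Delta$, and $M_4\in\mathrm{GL}_d(k_E+u^\Delta k_E[[u]])$. Let $M_7\in\mathrm{GL}_d(k_E)$ be a unipotent upper triangular matrix such that $M_4M_7$ satisfies Property (Z) with respect to $\Delta$ and an ordering $\{k_1,\dots,k_d\}$ of $\{1,\dots,d\}$. Suppose moreover that there exists $\delta>0$ with $r_{x+1}-r_x\ge\delta$ for all $1\le x\le d-1$ and $\Delta-r_d\ge\delta$. Then $M_3M_4M_7=Q\,[u^{r_{k_1}},\dots,u^{r_{k_d}}]$ for some $Q\in\mathrm{GL}_d(k_E+u^\delta k_E[[u]])$.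
   Context: $[a_1,\dots,a_d]$ denotes a diagonal matrix. $\mathrm{GL}_d(k_E+u^\Delta k_E[[u]])$ denotes invertible matrices with entries (and inverse entries) in the subring $k_E+u^\Delta k_E[[u]]\subset k_E[[u]]$. A matrix $N=(m_{z,x})\in\mathrm{GL}_d(k_E+u^\Delta k_E[[u]])$ satisfies Property (Z) (with respect to $\Delta$ and an ordering $\{k_1,\dots,k_d\}$ of $\{1,\dots,d\}$) if for each $1\le x\le d$: $m_{k_x,x}$ is the topmost entry of the $x$-th column of $N$ that is a unit of $k_E[[u]]$; $u^\Delta$ divides $m_{z,x}$ for all $z<k_x$ (if $\Delta=0$ this means $m_{z,x}=0$); and $m_{k_x,y}=0$ for all $y>x$. (For any $M_4\in\mathrm{GL}_d(k_E+u^\Delta k_E[[u]])$ such a unipotent $M_7$ exists.) -}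

module Defs where

open import Level using (Level; _⊔_; suc)
open import Data.Nat as ℕ using (ℕ; zero; _∸_)
  renaming (suc to sucℕ; _≤_ to _≤ℕ_; _<_ to _<ℕ_)
open import Data.Fin as Fin using (Fin; toℕ)
open import Data.Fin.Permutation using (Permutation′; _⟨$⟩ʳ_)
open import Data.Product using (Σ; ∃; _×_; _,_)
open import Relation.Nullary using (¬_)
open import Algebra.Bundles using (CommutativeRing)

record Field (c ℓ : Level) : Set (Level.suc (c ⊔ ℓ)) where
  field
    commutativeRing : CommutativeRing c ℓ
  open CommutativeRing commutativeRing public
  field
    0≉1     : ¬ (0# ≈ 1#)
    inverse : ∀ x → ¬ (x ≈ 0#) → ∃ λ y → x * y ≈ 1#

module PowerSeries {c ℓ : Level} (F : Field c ℓ) where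
  open Field F public

  sumK : ∀ m → (Fin m → Carrier) → Carrier
  sumK zero     f = 0#
  sumK (sucℕ m) f = f Fin.zero + sumK m (λ i → f (Fin.suc i))

  PS : Set c
  PS = ℕ → Carrier

  infix 4 _≈ₚ_
  _≈ₚ_ : PS → PS → Set ℓ
  f ≈ₚ g = ∀ n → f n ≈ g n

  0ₚ : PS
  0ₚ _ = 0#

  const : Carrier → PS
  const a zero     = a
  const a (sucℕ _) = 0#

  1ₚ : PS
  1ₚ = const 1#

  infixl 6 _+ₚ_
  _+ₚ_ : PS → PS → PS
  (f +ₚ g) n = f n + g n

  infixl 7 _*ₚ_
  _*ₚ_ : PS → PS → PS
  (f *ₚ g) n = sumK (sucℕ n) (λ i → f (toℕ i) * g (n ∸ toℕ i))

  u^ : ℕ → PS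
  u^ n m with n ℕ.≟ m
  ... | Relation.Nullary.yes _ = 1#
  ... | Relation.Nullary.no  _ = 0#

  IsUnit : PS → Set (c ⊔ ℓ)
  IsUnit f = ∃ λ g → f *ₚ g ≈ₚ 1ₚ

  InSub : ℕ → PS → Set (c ⊔ ℓ)
  InSub Δ f = Σ Carrier λ a → Σ PS λ g → f ≈ₚ const a +ₚ u^ Δ *ₚ g

  -- "u^Δ divides m", with the paper's convention that for Δ = 0 it means m = 0
  UDiv : ℕ → PS → Set (c ⊔ ℓ)
  UDiv zero     m = Level.Lift (c ⊔ ℓ) (m ≈ₚ 0ₚ)
  UDiv (sucℕ Δ) m = ∃ λ g → m ≈ₚ u^ (sucℕ Δ) *ₚ g

  Mat : ℕ → Set c
  Mat d = Fin d → Fin d → PS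

  sumP : ∀ m → (Fin m → PS) → PS
  sumP zero     f = 0ₚ
  sumP (sucℕ m) f = f Fin.zero +ₚ sumP m (λ i → f (Fin.suc i))

  infixl 7 _⊗_
  _⊗_ : ∀ {d} → Mat d → Mat d → Mat d
  (A ⊗ B) i j = sumP _ (λ k → A i k *ₚ B k j)

  infix 4 _≈ₘ_
  _≈ₘ_ : ∀ {d} → Mat d → Mat d → Set ℓ
  A ≈ₘ B = ∀ i j → A i j ≈ₚ B i j

  idM : ∀ {d} → Mat d
  idM i j with i Fin.≟ j
  ... | Relation.Nullary.yes _ = 1ₚ
  ... | Relation.Nullary.no  _ = 0ₚ

  diag : ∀ {d} → (Fin d → PS) → Mat d
  diag a i j with i Fin.≟ j
  ... | Relation.Nullary.yes _ = a i
  ... | Relation.Nullary.no  _ = 0ₚ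

  constM : ∀ {d} → (Fin d → Fin d → Carrier) → Mat d
  constM A i j = const (A i j)

  InGL : ∀ {d} → ℕ → Mat d → Set (c ⊔ ℓ)
  InGL Δ A = (∀ i j → InSub Δ (A i j))
           × ∃ λ B → (∀ i j → InSub Δ (B i j)) × (A ⊗ B ≈ₘ idM) × (B ⊗ A ≈ₘ idM)

  PropertyZ : ∀ {d} → ℕ → Permutation′ d → Mat d → Set (c ⊔ ℓ)
  PropertyZ {d} Δ k N =
      InGL Δ N
    × (∀ (x : Fin d) →
          IsUnit (N (k ⟨$⟩ʳ x) x)
        × (∀ (z : Fin d) → z Fin.< (k ⟨$⟩ʳ x) → ¬ IsUnit (N z x))
        × (∀ (z : Fin d) → z Fin.< (k ⟨$⟩ʳ x) → UDiv Δ (N z x))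
        × (∀ (y : Fin d) → x Fin.< y → N (k ⟨$⟩ʳ x) y ≈ₚ 0ₚ))

{-# OPTIONS --safe #-}
-- Let N = M4 M7, b_x = r_{k_x}, and D_r, D_b the diagonal matrices of the u^{r_x}, u^{b_x}.
-- Q = D_r N D_b⁻¹ satisfies D_r N = Q D_b and has inverse D_b N⁻¹ D_r⁻¹, so it suffices that the
-- entries u^{r_i - b_j} N_ij and u^{b_z - r_x} (N⁻¹)_zx lie in k_E + u^δ k_E[[u]]. As the r_x are
-- δ-separated and b_x ≤ Δ - δ, a positive exponent is at least δ, a zero exponent keeps an entry of
-- k_E + u^Δ k_E[[u]], and a negative exponent, at least δ - Δ, only occurs on entries divisible by
-- u^Δ: on N_ij with i < k_j by Property (Z), and on (N⁻¹)_zx with x > k_z because the constant term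
-- N̄ of N has its pivots at (k_x, x), which forces (N̄⁻¹)_zx = 0 for x > k_z, and an element of
-- k_E + u^Δ k_E[[u]] without constant term is divisible by u^Δ.
module Submission where

open import Defs
open import Level using (Level)
open import Data.Nat using (ℕ; zero; suc; _∸_; z≤n; s≤s; _<?_)
  renaming (_+_ to _+ℕ_; _≤_ to _≤ℕ_; _<_ to _<ℕ_)
import Data.Nat.Properties as ℕ
open import Data.Fin as Fin using (Fin; toℕ; opposite; punchIn)
open import Data.Fin.Properties as Fin using (opposite-prop; toℕ≤pred[n]; punchInᵢ≢i)
open import Data.Fin.Permutation using (Permutation′; _⟨$⟩ʳ_; _⟨$⟩ˡ_; inverseʳ; reverse)
open import Data.Fin.Induction using (>-wellFounded)
open import Data.Product using (∃; _×_; _,_; proj₁; proj₂)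
open import Data.Sum as Sum using (_⊎_; inj₂; [_,_]′)
open import Data.Empty using (⊥-elim)
open import Algebra.Bundles using (CommutativeRing)
open import Function using (_∘_)
open import Induction.WellFounded using (Acc; acc)
open import Relation.Binary using (Setoid; tri<; tri≈; tri>)
open import Relation.Binary.PropositionalEquality as ≡ using (_≡_; _≢_; subst₂)
open import Relation.Nullary using (Dec; yes; no)

module _ {n δ : ℕ} (r : Fin (suc n) → ℕ)
         (r-mono : ∀ (x y : Fin (suc n)) → x Fin.≤ y → r x ≤ℕ r y) where

  consecutiveGaps⇒gaps : (∀ (x : Fin n) → r (Fin.inject₁ x) +ℕ δ ≤ℕ r (Fin.suc x)) →
                         ∀ {x y} → x Fin.< y → r x +ℕ δ ≤ℕ r y
  consecutiveGaps⇒gaps gap {x} {Fin.suc y} x<y =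
    ℕ.≤-trans (ℕ.+-monoˡ-≤ δ (r-mono x (Fin.inject₁ y) (Fin.<⇒≤pred x<y))) (gap y)

  lastGap⇒gaps : ∀ {Δ} → r (Fin.fromℕ n) +ℕ δ ≤ℕ Δ → ∀ x → r x +ℕ δ ≤ℕ Δ
  lastGap⇒gaps top x = ℕ.≤-trans (ℕ.+-monoˡ-≤ δ (r-mono x (Fin.fromℕ n) (Fin.≤fromℕ x))) top

module CommutativeRingProperties {c ℓ : Level} (R : CommutativeRing c ℓ) where
  open CommutativeRing R
  open import Algebra.Properties.CommutativeMonoid.Sum +-commutativeMonoid
    using (sum; sum-cong-≋; sum-replicate-zero; sum-remove)
  open import Relation.Binary.Reasoning.Setoid setoid

  sum-zero : ∀ {m} {f : Fin m → Carrier} → (∀ i → f i ≈ 0#) → sum f ≈ 0#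
  sum-zero {m} f≈0 = trans (sum-cong-≋ f≈0) (sum-replicate-zero m)

  sum-single : ∀ {m} {f : Fin m → Carrier} (i : Fin m) → (∀ j → j ≢ i → f j ≈ 0#) → sum f ≈ f i
  sum-single {suc m} {f} i others = begin
    sum f                      ≈⟨ sum-remove {i = i} f ⟩
    f i + sum (f ∘ punchIn i)  ≈⟨ +-congˡ (sum-zero (λ j → others (punchIn i j) (punchInᵢ≢i i j))) ⟩
    f i + 0#                   ≈⟨ +-identityʳ (f i) ⟩
    f i                        ∎

  x*y≈0⇒x≈0 : ∀ {x y e} → x * y ≈ 0# → y * e ≈ 1# → x ≈ 0#
  x*y≈0⇒x≈0 {x} {y} {e} x*y≈0 y*e≈1 = begin
    x            ≈⟨ *-identityʳ x ⟨
    x * 1#       ≈⟨ *-congˡ y*e≈1 ⟨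
    x * (y * e)  ≈⟨ *-assoc x y e ⟨
    (x * y) * e  ≈⟨ *-congʳ x*y≈0 ⟩
    0# * e       ≈⟨ zeroˡ e ⟩
    0#           ∎

  module _ {d} (k : Permutation′ d) (N B : Fin d → Fin d → Carrier)
    (zero-above-pivot    : ∀ w {y} → y Fin.< k ⟨$⟩ʳ w → N y w ≈ 0#)
    (pivot-invertible    : ∀ w → ∃ λ e → N (k ⟨$⟩ʳ w) w * e ≈ 1#)
    (zero-right-of-pivot : ∀ w {y} → w Fin.< y → N (k ⟨$⟩ʳ w) y ≈ 0#)
    (BN-offDiagonal      : ∀ {z v} → z ≢ v → sum (λ y → B z y * N y v) ≈ 0#)
    where

    private
      κ : Fin d → Fin d
      κ = k ⟨$⟩ʳ_

      -- Downward induction on v. In the entry (z, v) of B N = I only the pivot term survives: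
      -- terms above the pivot vanish in N, and those past it either in N or by induction.
      vanishes : ∀ {v} → Acc Fin._>_ v → ∀ {z} → z Fin.< v ⊎ κ z Fin.< κ v → B z (κ v) ≈ 0#
      vanishes {v} (acc rec) {z} z-before-v = x*y≈0⇒x≈0 pivot-term (proj₂ (pivot-invertible v))
        where
        z≢v : z ≢ v
        z≢v ≡.refl = [ Fin.<-irrefl ≡.refl , Fin.<-irrefl ≡.refl ]′ z-before-v

        past-pivot : ∀ w → κ v Fin.< κ w → B z (κ w) * N (κ w) v ≈ 0#
        past-pivot w κv<κw with Fin.<-cmp w v
        ... | tri< w<v _ _    = trans (*-congˡ (zero-right-of-pivot w w<v)) (zeroʳ _)
        ... | tri≈ _ ≡.refl _ = ⊥-elim (Fin.<-irrefl ≡.refl κv<κw)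
        ... | tri> _ _ v<w    = trans (*-congʳ (vanishes (rec v<w) z-before-w)) (zeroˡ _)
          where
          z-before-w = Sum.map (λ z<v → Fin.<-trans z<v v<w) (λ κz<κv → Fin.<-trans κz<κv κv<κw)
                               z-before-v

        off-pivot : ∀ y → y ≢ κ v → B z y * N y v ≈ 0#
        off-pivot y y≢κv with Fin.<-cmp y (κ v)
        ... | tri< y<κv _ _ = trans (*-congˡ (zero-above-pivot v y<κv)) (zeroʳ _)
        ... | tri≈ _ y≡κv _ = ⊥-elim (y≢κv y≡κv)
        ... | tri> _ _ κv<y = ≡.subst (λ y → B z y * N y v ≈ 0#) (inverseʳ k)
                                (past-pivot (k ⟨$⟩ˡ y) (≡.subst (κ v Fin.<_) (≡.sym (inverseʳ k)) κv<y))

        pivot-term : B z (κ v) * N (κ v) v ≈ 0#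
        pivot-term = trans (sym (sum-single (κ v) off-pivot)) (BN-offDiagonal z≢v)

    leftInverse-zero-right-of-pivot : ∀ {z x} → κ z Fin.< x → B z x ≈ 0#
    leftInverse-zero-right-of-pivot {z} κz<x =
      ≡.subst (λ x → B z x ≈ 0#) (inverseʳ k)
        (vanishes (>-wellFounded _) (inj₂ (≡.subst (κ z Fin.<_) (≡.sym (inverseʳ k)) κz<x)))

module PowerSeriesProperties {c ℓ : Level} (F : Field c ℓ) where
  open PowerSeries F
  open import Algebra.Properties.CommutativeMonoid.Sum +-commutativeMonoid
    using (sum; sum-syntax; sum⁺-syntax; sum-cong-≋; sum-permute)
  open CommutativeRingProperties commutativeRing using (sum-zero; sum-single)
  open import Relation.Binary.Reasoning.Setoid setoid

  ≈ₚ-setoid : Setoid c ℓ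
  ≈ₚ-setoid = record
    { Carrier       = PS
    ; _≈_           = _≈ₚ_
    ; isEquivalence = record
      { refl  = λ _ → refl
      ; sym   = λ f≈g n → sym (f≈g n)
      ; trans = λ f≈g g≈h n → trans (f≈g n) (g≈h n)
      }
    }

  open Setoid ≈ₚ-setoid public using ()
    renaming (refl to ≈ₚ-refl; sym to ≈ₚ-sym; trans to ≈ₚ-trans; reflexive to ≈ₚ-reflexive)

  sumK≡sum : ∀ m (f : Fin m → Carrier) → sumK m f ≡ sum f
  sumK≡sum zero    f = ≡.refl
  sumK≡sum (suc m) f = ≡.cong (f Fin.zero +_) (sumK≡sum m (f ∘ Fin.suc))

  sumP-coeff : ∀ m (G : Fin m → PS) n → sumP m G n ≡ sum (λ i → G i n)
  sumP-coeff zero    G n = ≡.refl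
  sumP-coeff (suc m) G n = ≡.cong (G Fin.zero n +_) (sumP-coeff m (G ∘ Fin.suc) n)

  *ₚ-coeff : ∀ f g n → (f *ₚ g) n ≡ ∑[ i ≤ n ] (f (toℕ i) * g (n ∸ toℕ i))
  *ₚ-coeff f g n = sumK≡sum (suc n) (λ i → f (toℕ i) * g (n ∸ toℕ i))

  +ₚ-cong : ∀ {f f′ g g′} → f ≈ₚ f′ → g ≈ₚ g′ → f +ₚ g ≈ₚ f′ +ₚ g′
  +ₚ-cong f≈f′ g≈g′ n = +-cong (f≈f′ n) (g≈g′ n)

  *ₚ-cong : ∀ {f f′ g g′} → f ≈ₚ f′ → g ≈ₚ g′ → f *ₚ g ≈ₚ f′ *ₚ g′
  *ₚ-cong {f} {f′} {g} {g′} f≈f′ g≈g′ n = begin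
    (f *ₚ g) n
      ≡⟨ *ₚ-coeff f g n ⟩
    ∑[ i ≤ n ] (f (toℕ i) * g (n ∸ toℕ i))
      ≈⟨ sum-cong-≋ {suc n} (λ i → *-cong (f≈f′ (toℕ i)) (g≈g′ (n ∸ toℕ i))) ⟩
    ∑[ i ≤ n ] (f′ (toℕ i) * g′ (n ∸ toℕ i))
      ≡⟨ *ₚ-coeff f′ g′ n ⟨
    (f′ *ₚ g′) n
      ∎

  sumP-cong : ∀ m {G G′ : Fin m → PS} → (∀ i → G i ≈ₚ G′ i) → sumP m G ≈ₚ sumP m G′
  sumP-cong zero    G≈G′ = ≈ₚ-refl
  sumP-cong (suc m) G≈G′ = +ₚ-cong (G≈G′ Fin.zero) (sumP-cong m (G≈G′ ∘ Fin.suc))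

  sumP-single : ∀ {m} {G : Fin m → PS} (i : Fin m) → (∀ j → j ≢ i → G j ≈ₚ 0ₚ) → sumP m G ≈ₚ G i
  sumP-single {m} {G} i others n = begin
    sumP m G n           ≡⟨ sumP-coeff m G n ⟩
    sum (λ j → G j n)    ≈⟨ sum-single i (λ j j≢i → others j j≢i n) ⟩
    G i n                ∎

  *ₚ-comm : ∀ f g → f *ₚ g ≈ₚ g *ₚ f
  *ₚ-comm f g n = begin
    (f *ₚ g) n
      ≡⟨ *ₚ-coeff f g n ⟩
    ∑[ i ≤ n ] (f (toℕ i) * g (n ∸ toℕ i))
      ≈⟨ sum-permute {suc n} (λ i → f (toℕ i) * g (n ∸ toℕ i)) reverse ⟩
    ∑[ i ≤ n ] (f (toℕ (opposite i)) * g (n ∸ toℕ (opposite i)))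
      ≈⟨ sum-cong-≋ {suc n} reversed ⟩
    ∑[ i ≤ n ] (g (toℕ i) * f (n ∸ toℕ i))
      ≡⟨ *ₚ-coeff g f n ⟨
    (g *ₚ f) n
      ∎
    where
    reversed : ∀ (i : Fin (suc n)) →
               f (toℕ (opposite i)) * g (n ∸ toℕ (opposite i)) ≈ g (toℕ i) * f (n ∸ toℕ i)
    reversed i = begin
      f (toℕ (opposite i)) * g (n ∸ toℕ (opposite i))
        ≡⟨ ≡.cong (λ m → f m * g (n ∸ m)) (opposite-prop i) ⟩
      f (n ∸ toℕ i) * g (n ∸ (n ∸ toℕ i))
        ≡⟨ ≡.cong (λ m → f (n ∸ toℕ i) * g m) (ℕ.m∸[m∸n]≡n (toℕ≤pred[n] i)) ⟩
      f (n ∸ toℕ i) * g (toℕ i)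
        ≈⟨ *-comm _ _ ⟩
      g (toℕ i) * f (n ∸ toℕ i)
        ∎

  *ₚ-zeroˡ : ∀ f → 0ₚ *ₚ f ≈ₚ 0ₚ
  *ₚ-zeroˡ f n = trans (reflexive (*ₚ-coeff 0ₚ f n)) (sum-zero {suc n} (λ i → zeroˡ (f (n ∸ toℕ i))))

  *ₚ-zeroʳ : ∀ f → f *ₚ 0ₚ ≈ₚ 0ₚ
  *ₚ-zeroʳ f = ≈ₚ-trans (*ₚ-comm f 0ₚ) (*ₚ-zeroˡ f)

  *ₚ-identityˡ : ∀ f → 1ₚ *ₚ f ≈ₚ f
  *ₚ-identityˡ f n = begin
    1# * f n + sumK n (λ i → 0# * f (n ∸ suc (toℕ i)))
      ≈⟨ +-cong (*-identityˡ (f n)) (reflexive (sumK≡sum n _)) ⟩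
    f n + ∑[ i < n ] (0# * f (n ∸ suc (toℕ i)))
      ≈⟨ +-congˡ (sum-zero {n} (λ i → zeroˡ (f (n ∸ suc (toℕ i))))) ⟩
    f n + 0#
      ≈⟨ +-identityʳ (f n) ⟩
    f n
      ∎

  *ₚ-constantTerm : ∀ f g → (f *ₚ g) 0 ≈ f 0 * g 0
  *ₚ-constantTerm f g = +-identityʳ _

  shift₁ : PS → PS
  shift₁ f zero    = 0#
  shift₁ f (suc n) = f n

  shift : ℕ → PS → PS
  shift zero    f = f
  shift (suc a) f = shift₁ (shift a f)

  shift-+ : ∀ a f m → shift a f (a +ℕ m) ≡ f m
  shift-+ zero    f m = ≡.refl
  shift-+ (suc a) f m = shift-+ a f m

  shift-≥ : ∀ a f {n} → a ≤ℕ n → shift a f n ≡ f (n ∸ a)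
  shift-≥ zero    f         a≤n       = ≡.refl
  shift-≥ (suc a) f {suc n} (s≤s a≤n) = shift-≥ a f a≤n

  shift-< : ∀ a f {n} → n <ℕ a → shift a f n ≡ 0#
  shift-< (suc a) f {zero}  _         = ≡.refl
  shift-< (suc a) f {suc n} (s≤s n<a) = shift-< a f n<a

  shift₁-cong : ∀ {f g} → f ≈ₚ g → shift₁ f ≈ₚ shift₁ g
  shift₁-cong f≈g zero    = refl
  shift₁-cong f≈g (suc n) = f≈g n

  shift-cong : ∀ a {f g} → f ≈ₚ g → shift a f ≈ₚ shift a g
  shift-cong zero    f≈g = f≈g
  shift-cong (suc a) f≈g = shift₁-cong (shift-cong a f≈g)

  shift-injective : ∀ a {f g} → shift a f ≈ₚ shift a g → f ≈ₚ g
  shift-injective a {f} {g} shift≈ m = subst₂ _≈_ (shift-+ a f m) (shift-+ a g m) (shift≈ (a +ℕ m))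

  shift-0ₚ : ∀ a → shift a 0ₚ ≈ₚ 0ₚ
  shift-0ₚ zero    n       = refl
  shift-0ₚ (suc a) zero    = refl
  shift-0ₚ (suc a) (suc n) = shift-0ₚ a n

  shift-+ₚ : ∀ a f g → shift a (f +ₚ g) ≈ₚ shift a f +ₚ shift a g
  shift-+ₚ zero    f g n       = refl
  shift-+ₚ (suc a) f g zero    = sym (+-identityʳ 0#)
  shift-+ₚ (suc a) f g (suc n) = shift-+ₚ a f g n

  shift-sumP : ∀ a m (G : Fin m → PS) → shift a (sumP m G) ≈ₚ sumP m (shift a ∘ G)
  shift-sumP a zero    G = shift-0ₚ a
  shift-sumP a (suc m) G =
    ≈ₚ-trans (shift-+ₚ a _ _) (+ₚ-cong ≈ₚ-refl (shift-sumP a m (G ∘ Fin.suc)))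

  -- The Cauchy sum for shift₁ f *ₚ g at suc n is 0# * g (suc n) + (f *ₚ g) n definitionally.
  shift₁-*ₚ : ∀ f g → shift₁ f *ₚ g ≈ₚ shift₁ (f *ₚ g)
  shift₁-*ₚ f g zero    = trans (+-identityʳ _) (zeroˡ (g 0))
  shift₁-*ₚ f g (suc n) = trans (+-congʳ (zeroˡ (g (suc n)))) (+-identityˡ _)

  shift-*ₚ : ∀ a f g → shift a f *ₚ g ≈ₚ shift a (f *ₚ g)
  shift-*ₚ zero    f g = ≈ₚ-refl
  shift-*ₚ (suc a) f g = ≈ₚ-trans (shift₁-*ₚ (shift a f) g) (shift₁-cong (shift-*ₚ a f g))

  *ₚ-shift : ∀ a f g → f *ₚ shift a g ≈ₚ shift a (f *ₚ g)
  *ₚ-shift a f g = ≈ₚ-trans (*ₚ-comm f (shift a g))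
                   (≈ₚ-trans (shift-*ₚ a g f) (shift-cong a (*ₚ-comm g f)))

  VanishesBelow : ℕ → PS → Set ℓ
  VanishesBelow m f = ∀ {q} → q <ℕ m → f q ≈ 0#

  VanishesBelow-mono : ∀ {m m′ f} → m ≤ℕ m′ → VanishesBelow m′ f → VanishesBelow m f
  VanishesBelow-mono m≤m′ f≈0 q<m = f≈0 (ℕ.<-≤-trans q<m m≤m′)

  shift-vanishing : ∀ a {m f} → VanishesBelow m f → VanishesBelow (a +ℕ m) (shift a f)
  shift-vanishing zero    f≈0 n<m             = f≈0 n<m
  shift-vanishing (suc a) f≈0 {zero}  _       = refl
  shift-vanishing (suc a) f≈0 {suc n} (s≤s n<) = shift-vanishing a f≈0 n<

  u^-on : ∀ {a n} → a ≡ n → u^ a n ≡ 1#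
  u^-on {a} {n} a≡n with a ℕ.≟ n
  ... | yes _   = ≡.refl
  ... | no  a≢n = ⊥-elim (a≢n a≡n)

  u^-off : ∀ {a n} → a ≢ n → u^ a n ≡ 0#
  u^-off {a} {n} a≢n with a ℕ.≟ n
  ... | yes a≡n = ⊥-elim (a≢n a≡n)
  ... | no  _   = ≡.refl

  u^-suc : ∀ a n → u^ (suc a) (suc n) ≡ u^ a n
  u^-suc a n = by-cases (a ℕ.≟ n)
    where
    by-cases : Dec (a ≡ n) → u^ (suc a) (suc n) ≡ u^ a n
    by-cases (yes a≡n) = ≡.trans (u^-on (≡.cong suc a≡n)) (≡.sym (u^-on a≡n))
    by-cases (no  a≢n) = ≡.trans (u^-off (a≢n ∘ ℕ.suc-injective)) (≡.sym (u^-off a≢n))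

  u^≈shift-1ₚ : ∀ a → u^ a ≈ₚ shift a 1ₚ
  u^≈shift-1ₚ zero    zero    = reflexive (u^-on {0} ≡.refl)
  u^≈shift-1ₚ zero    (suc n) = reflexive (u^-off {0} {suc n} (λ ()))
  u^≈shift-1ₚ (suc a) zero    = reflexive (u^-off {suc a} {0} (λ ()))
  u^≈shift-1ₚ (suc a) (suc n) = trans (reflexive (u^-suc a n)) (u^≈shift-1ₚ a n)

  u^-*ₚ : ∀ a f → u^ a *ₚ f ≈ₚ shift a f
  u^-*ₚ a f = ≈ₚ-trans (*ₚ-cong (u^≈shift-1ₚ a) ≈ₚ-refl)
              (≈ₚ-trans (shift-*ₚ a 1ₚ f) (shift-cong a (*ₚ-identityˡ f)))

  *ₚ-u^ : ∀ a f → f *ₚ u^ a ≈ₚ shift a f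
  *ₚ-u^ a f = ≈ₚ-trans (*ₚ-comm f (u^ a)) (u^-*ₚ a f)

  InSub⇒coeff≈0 : ∀ {Δ f} → InSub Δ f → ∀ {q} → 0 <ℕ q → q <ℕ Δ → f q ≈ 0#
  InSub⇒coeff≈0 {Δ} {f} (_ , g , f≈) {suc q} _ q<Δ = begin
    f (suc q)                   ≈⟨ f≈ (suc q) ⟩
    0# + (u^ Δ *ₚ g) (suc q)    ≈⟨ +-identityˡ _ ⟩
    (u^ Δ *ₚ g) (suc q)         ≈⟨ u^-*ₚ Δ g (suc q) ⟩
    shift Δ g (suc q)           ≡⟨ shift-< Δ g q<Δ ⟩
    0#                          ∎

  coeff≈0⇒InSub : ∀ {δ G} → 0 <ℕ δ → (∀ {p} → 0 <ℕ p → p <ℕ δ → G p ≈ 0#) → InSub δ G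
  coeff≈0⇒InSub {δ} {G} 0<δ G≈0 =
    G 0 , tail , λ n → sym (trans (+-congˡ (u^-*ₚ δ tail n)) (recombine n))
    where
    tail : PS
    tail p = G (δ +ℕ p)

    recombine : ∀ n → const (G 0) n + shift δ tail n ≈ G n
    recombine zero = trans (+-congˡ (reflexive (shift-< δ tail 0<δ))) (+-identityʳ (G 0))
    recombine (suc n) with suc n <? δ
    ... | yes n<δ = trans (+-identityˡ _)
                    (trans (reflexive (shift-< δ tail n<δ)) (sym (G≈0 (s≤s z≤n) n<δ)))
    ... | no  n≮δ = trans (+-identityˡ _)
                    (reflexive (≡.trans (shift-≥ δ tail δ≤n) (≡.cong G (ℕ.m+[n∸m]≡n δ≤n))))
      where δ≤n = ℕ.≮⇒≥ n≮δ

  InSub⇒VanishesBelow : ∀ {Δ f} → InSub Δ f → f 0 ≈ 0# → VanishesBelow Δ f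
  InSub⇒VanishesBelow f∈ f₀≈0 {zero}  _   = f₀≈0
  InSub⇒VanishesBelow f∈ f₀≈0 {suc q} q<Δ = InSub⇒coeff≈0 f∈ (s≤s z≤n) q<Δ

  UDiv⇒VanishesBelow : ∀ Δ {f} → UDiv Δ f → VanishesBelow Δ f
  UDiv⇒VanishesBelow (suc Δ) {f} (g , f≈) {q} q<Δ = begin
    f q                         ≈⟨ f≈ q ⟩
    (u^ (suc Δ) *ₚ g) q         ≈⟨ u^-*ₚ (suc Δ) g q ⟩
    shift (suc Δ) g q           ≡⟨ shift-< (suc Δ) g q<Δ ⟩
    0#                          ∎

  -- rescale a c f stands for u^a f / u^c; it is exact when c ≤ a or f vanishes below c.
  rescale : ℕ → ℕ → PS → PS
  rescale a c f p = shift a f (p +ℕ c)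

  shift-rescale : ∀ a c {f} → (a <ℕ c → VanishesBelow c f) → shift c (rescale a c f) ≈ₚ shift a f
  shift-rescale a c {f} low n with n <? c
  ... | no  n≮c = reflexive (≡.trans (shift-≥ c _ c≤n) (≡.cong (shift a f) (ℕ.m∸n+n≡m c≤n)))
    where c≤n = ℕ.≮⇒≥ n≮c
  ... | yes n<c with a <? c
  ...   | yes a<c = trans (reflexive (shift-< c _ n<c))
                    (sym (shift-vanishing a (low a<c) (ℕ.<-≤-trans n<c (ℕ.m≤n+m c a))))
  ...   | no  a≮c = trans (reflexive (shift-< c _ n<c))
                    (sym (reflexive (shift-< a f (ℕ.<-≤-trans n<c (ℕ.≮⇒≥ a≮c)))))

  rescale-InSub : ∀ {a c δ Δ f} → 0 <ℕ δ → c +ℕ δ ≤ℕ Δ → (c <ℕ a → c +ℕ δ ≤ℕ a) →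
                  InSub Δ f → (a <ℕ c → VanishesBelow Δ f) → InSub δ (rescale a c f)
  rescale-InSub {a} {c} {δ} {Δ} {f} 0<δ c+δ≤Δ gap f∈ low = coeff≈0⇒InSub 0<δ vanish
    where
    p+c<c+δ : ∀ {p} → p <ℕ δ → p +ℕ c <ℕ c +ℕ δ
    p+c<c+δ {p} p<δ = ≡.subst (p +ℕ c <ℕ_) (ℕ.+-comm δ c) (ℕ.+-monoˡ-< c p<δ)

    vanish : ∀ {p} → 0 <ℕ p → p <ℕ δ → shift a f (p +ℕ c) ≈ 0#
    vanish {p} 0<p p<δ with ℕ.<-cmp a c
    ... | tri< a<c _ _ =
      shift-vanishing a (low a<c) (ℕ.<-≤-trans (p+c<c+δ p<δ) (ℕ.≤-trans c+δ≤Δ (ℕ.m≤n+m Δ a)))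
    ... | tri≈ _ ≡.refl _ =
      trans (reflexive (≡.trans (≡.cong (shift a f) (ℕ.+-comm p a)) (shift-+ a f p)))
            (InSub⇒coeff≈0 f∈ 0<p (ℕ.<-≤-trans p<δ (ℕ.m+n≤o⇒n≤o c c+δ≤Δ)))
    ... | tri> _ _ c<a = reflexive (shift-< a f (ℕ.<-≤-trans (p+c<c+δ p<δ) (gap c<a)))

  diag-on : ∀ {d} (v : Fin d → PS) i → diag v i i ≡ v i
  diag-on v i with i Fin.≟ i
  ... | yes _   = ≡.refl
  ... | no  i≢i = ⊥-elim (i≢i ≡.refl)

  diag-off : ∀ {d} (v : Fin d → PS) {i j} → i ≢ j → diag v i j ≡ 0ₚ
  diag-off v {i} {j} i≢j with i Fin.≟ j
  ... | yes i≡j = ⊥-elim (i≢j i≡j)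
  ... | no  _   = ≡.refl

  idM-off : ∀ {d} {i j : Fin d} → i ≢ j → idM i j ≡ 0ₚ
  idM-off {i = i} {j} i≢j with i Fin.≟ j
  ... | yes i≡j = ⊥-elim (i≢j i≡j)
  ... | no  _   = ≡.refl

  diag-⊗ : ∀ {d} (v : Fin d → PS) (X : Mat d) i j → (diag v ⊗ X) i j ≈ₚ v i *ₚ X i j
  diag-⊗ v X i j = ≈ₚ-trans (sumP-single i off) (≈ₚ-reflexive (≡.cong (_*ₚ X i j) (diag-on v i)))
    where
    off : ∀ m → m ≢ i → diag v i m *ₚ X m j ≈ₚ 0ₚ
    off m m≢i = ≈ₚ-trans (≈ₚ-reflexive (≡.cong (_*ₚ X m j) (diag-off v (m≢i ∘ ≡.sym)))) (*ₚ-zeroˡ (X m j))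

  ⊗-diag : ∀ {d} (v : Fin d → PS) (X : Mat d) i j → (X ⊗ diag v) i j ≈ₚ X i j *ₚ v j
  ⊗-diag v X i j = ≈ₚ-trans (sumP-single j off) (≈ₚ-reflexive (≡.cong (X i j *ₚ_) (diag-on v j)))
    where
    off : ∀ m → m ≢ j → X i m *ₚ diag v m j ≈ₚ 0ₚ
    off m m≢j = ≈ₚ-trans (≈ₚ-reflexive (≡.cong (X i m *ₚ_) (diag-off v m≢j))) (*ₚ-zeroʳ (X i m))

  ⊗-constantTerm : ∀ {d} (X Y : Mat d) i j → (X ⊗ Y) i j 0 ≈ sum (λ m → X i m 0 * Y m j 0)
  ⊗-constantTerm {d} X Y i j =
    trans (reflexive (sumP-coeff d _ 0)) (sum-cong-≋ {d} (λ m → *ₚ-constantTerm (X i m) (Y m j)))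

  u^-diag-⊗-⊗ : ∀ {d} (α : Fin d → ℕ) (X Y : Mat d) i j →
                (diag (λ x → u^ (α x)) ⊗ X ⊗ Y) i j ≈ₚ shift (α i) ((X ⊗ Y) i j)
  u^-diag-⊗-⊗ {d} α X Y i j n = begin
    sumP d (λ m → (diag (λ x → u^ (α x)) ⊗ X) i m *ₚ Y m j) n
      ≈⟨ sumP-cong d (λ m → *ₚ-cong (≈ₚ-trans (diag-⊗ _ X i m) (u^-*ₚ (α i) (X i m)))
                                    (≈ₚ-refl {Y m j})) n ⟩
    sumP d (λ m → shift (α i) (X i m) *ₚ Y m j) n
      ≈⟨ sumP-cong d (λ m → shift-*ₚ (α i) (X i m) (Y m j)) n ⟩
    sumP d (λ m → shift (α i) (X i m *ₚ Y m j)) n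
      ≈⟨ shift-sumP (α i) d (λ m → X i m *ₚ Y m j) n ⟨
    shift (α i) ((X ⊗ Y) i j) n
      ∎

  ⊗-u^-diag : ∀ {d} (β : Fin d → ℕ) (X : Mat d) i j →
              (X ⊗ diag (λ x → u^ (β x))) i j ≈ₚ shift (β j) (X i j)
  ⊗-u^-diag β X i j = ≈ₚ-trans (⊗-diag _ X i j) (*ₚ-u^ (β j) (X i j))

  -- The hypotheses say X′ D_β = D_α X and Y′ D_α = D_β Y, where D_α = diag u^α and D_β = diag u^β.
  conjugate-inverse : ∀ {d} {X Y X′ Y′ : Mat d} (α β : Fin d → ℕ) →
    (∀ i m → shift (β m) (X′ i m) ≈ₚ shift (α i) (X i m)) →
    (∀ m j → shift (α j) (Y′ m j) ≈ₚ shift (β m) (Y m j)) →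
    X ⊗ Y ≈ₘ idM → X′ ⊗ Y′ ≈ₘ idM
  conjugate-inverse {d} {X} {Y} {X′} {Y′} α β X′≈X Y′≈Y XY≈I i j =
    shift-injective (α j) λ n → begin
    shift (α j) ((X′ ⊗ Y′) i j) n
      ≈⟨ shift-sumP (α j) d (λ m → X′ i m *ₚ Y′ m j) n ⟩
    sumP d (λ m → shift (α j) (X′ i m *ₚ Y′ m j)) n
      ≈⟨ sumP-cong d (λ m → ≈ₚ-sym (*ₚ-shift (α j) (X′ i m) (Y′ m j))) n ⟩
    sumP d (λ m → X′ i m *ₚ shift (α j) (Y′ m j)) n
      ≈⟨ sumP-cong d (λ m → *ₚ-cong {X′ i m} ≈ₚ-refl (Y′≈Y m j)) n ⟩
    sumP d (λ m → X′ i m *ₚ shift (β m) (Y m j)) n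
      ≈⟨ sumP-cong d (λ m → ≈ₚ-trans (*ₚ-shift (β m) (X′ i m) (Y m j))
                                     (≈ₚ-sym (shift-*ₚ (β m) (X′ i m) (Y m j)))) n ⟩
    sumP d (λ m → shift (β m) (X′ i m) *ₚ Y m j) n
      ≈⟨ sumP-cong d (λ m → ≈ₚ-trans (*ₚ-cong {g = Y m j} (X′≈X i m) ≈ₚ-refl)
                                     (shift-*ₚ (α i) (X i m) (Y m j))) n ⟩
    sumP d (λ m → shift (α i) (X i m *ₚ Y m j)) n
      ≈⟨ shift-sumP (α i) d (λ m → X i m *ₚ Y m j) n ⟨
    shift (α i) ((X ⊗ Y) i j) n
      ≈⟨ shift-cong (α i) (XY≈I i j) n ⟩
    shift (α i) (idM i j) n
      ≈⟨ shift-idM (i Fin.≟ j) n ⟩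
    shift (α j) (idM i j) n
      ∎
    where
    shift-idM : Dec (i ≡ j) → shift (α i) (idM i j) ≈ₚ shift (α j) (idM i j)
    shift-idM (yes i≡j) = ≈ₚ-reflexive (≡.cong (λ x → shift (α x) (idM i j)) i≡j)
    shift-idM (no  i≢j) = ≈ₚ-trans (vanishing (α i)) (≈ₚ-sym (vanishing (α j)))
      where
      vanishing : ∀ a → shift a (idM i j) ≈ₚ 0ₚ
      vanishing a = ≈ₚ-trans (shift-cong a (≈ₚ-reflexive (idM-off i≢j))) (shift-0ₚ a)

module PivotConjugation {c ℓ : Level} (F : Field c ℓ) {d Δ δ : ℕ} (r : Fin d → ℕ) (k : Permutation′ d)
  {N : PowerSeries.Mat F d}
  (0<δ       : 0 <ℕ δ)
  (r-gap     : ∀ {x y} → x Fin.< y → r x +ℕ δ ≤ℕ r y)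
  (r-room    : ∀ x → r x +ℕ δ ≤ℕ Δ)
  (N-pivoted : PowerSeries.PropertyZ F Δ k N)
  where

  open PowerSeries F
  open PowerSeriesProperties F
  open CommutativeRingProperties commutativeRing using (leftInverse-zero-right-of-pivot)
  open import Algebra.Properties.CommutativeMonoid.Sum +-commutativeMonoid using (sum)

  private
    κ : Fin d → Fin d
    κ = k ⟨$⟩ʳ_

    N∈Sub : ∀ i j → InSub Δ (N i j)
    N∈Sub = proj₁ (proj₁ N-pivoted)

    B : Mat d
    B = proj₁ (proj₂ (proj₁ N-pivoted))

    B∈Sub : ∀ i j → InSub Δ (B i j)
    B∈Sub = proj₁ (proj₂ (proj₂ (proj₁ N-pivoted)))

    NB≈I : N ⊗ B ≈ₘ idM
    NB≈I = proj₁ (proj₂ (proj₂ (proj₂ (proj₁ N-pivoted))))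

    BN≈I : B ⊗ N ≈ₘ idM
    BN≈I = proj₂ (proj₂ (proj₂ (proj₂ (proj₁ N-pivoted))))

    pivot-unit : ∀ w → IsUnit (N (κ w) w)
    pivot-unit w = proj₁ (proj₂ N-pivoted w)

    N-divisible : ∀ w {y} → y Fin.< κ w → UDiv Δ (N y w)
    N-divisible w = proj₁ (proj₂ (proj₂ (proj₂ N-pivoted w))) _

    N-zero-right-of-pivot : ∀ w {y} → w Fin.< y → N (κ w) y ≈ₚ 0ₚ
    N-zero-right-of-pivot w = proj₂ (proj₂ (proj₂ (proj₂ N-pivoted w))) _

    r≤Δ : ∀ x → r x ≤ℕ Δ
    r≤Δ x = ℕ.≤-trans (ℕ.m≤m+n (r x) δ) (r-room x)

    r-reflects-< : ∀ {x y} → r x <ℕ r y → x Fin.< y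
    r-reflects-< {x} {y} rx<ry with Fin.<-cmp x y
    ... | tri< x<y _ _    = x<y
    ... | tri≈ _ ≡.refl _ = ⊥-elim (ℕ.<-irrefl ≡.refl rx<ry)
    ... | tri> _ _ y<x    = ⊥-elim (ℕ.<⇒≱ rx<ry (ℕ.≤-trans (ℕ.m≤m+n (r y) δ) (r-gap y<x)))

    r-<⇒gap : ∀ {x y} → r x <ℕ r y → r x +ℕ δ ≤ℕ r y
    r-<⇒gap = r-gap ∘ r-reflects-<

    0<Δ : Fin d → 0 <ℕ Δ
    0<Δ x = ℕ.<-≤-trans 0<δ (ℕ.m+n≤o⇒n≤o (r x) (r-room x))

    pivot-unit₀ : ∀ w → ∃ λ e → N (κ w) w 0 * e ≈ 1#
    pivot-unit₀ w with pivot-unit w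
    ... | e , Ne≈1 = e 0 , trans (sym (*ₚ-constantTerm (N (κ w) w) e)) (Ne≈1 0)

    BN₀-offDiagonal : ∀ {z v} → z ≢ v → sum (λ y → B z y 0 * N y v 0) ≈ 0#
    BN₀-offDiagonal {z} {v} z≢v =
      trans (sym (⊗-constantTerm B N z v))
            (trans (BN≈I z v 0) (reflexive (≡.cong (λ f → f 0) (idM-off z≢v))))

    B-zero-right-of-pivot : ∀ {z x} → κ z Fin.< x → B z x 0 ≈ 0#
    B-zero-right-of-pivot = leftInverse-zero-right-of-pivot k (λ y w → N y w 0) (λ z x → B z x 0)
      (λ w y<κw → UDiv⇒VanishesBelow Δ (N-divisible w y<κw) (0<Δ w))
      pivot-unit₀
      (λ w w<y → N-zero-right-of-pivot w w<y 0)
      BN₀-offDiagonal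

    N-low : ∀ i j → r i <ℕ r (κ j) → VanishesBelow Δ (N i j)
    N-low i j ri<rκj = UDiv⇒VanishesBelow Δ (N-divisible j (r-reflects-< ri<rκj))

    B-low : ∀ z x → r (κ z) <ℕ r x → VanishesBelow Δ (B z x)
    B-low z x rκz<rx = InSub⇒VanishesBelow (B∈Sub z x) (B-zero-right-of-pivot (r-reflects-< rκz<rx))

  Q : Mat d
  Q i j = rescale (r i) (r (κ j)) (N i j)

  shift-Q : ∀ i j → shift (r (κ j)) (Q i j) ≈ₚ shift (r i) (N i j)
  shift-Q i j = shift-rescale (r i) (r (κ j)) (λ lt → VanishesBelow-mono (r≤Δ (κ j)) (N-low i j lt))

  private
    Q′ : Mat d
    Q′ z x = rescale (r (κ z)) (r x) (B z x)

    shift-Q′ : ∀ z x → shift (r x) (Q′ z x) ≈ₚ shift (r (κ z)) (B z x)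
    shift-Q′ z x = shift-rescale (r (κ z)) (r x) (λ lt → VanishesBelow-mono (r≤Δ x) (B-low z x lt))

  Q∈GL : InGL δ Q
  Q∈GL = (λ i j → rescale-InSub 0<δ (r-room (κ j)) r-<⇒gap (N∈Sub i j) (N-low i j))
       , Q′
       , (λ z x → rescale-InSub 0<δ (r-room x) r-<⇒gap (B∈Sub z x) (B-low z x))
       , conjugate-inverse r (r ∘ κ) shift-Q shift-Q′ NB≈I
       , conjugate-inverse (r ∘ κ) r shift-Q′ shift-Q BN≈I

lemma3p1p3 : ∀ {c ℓ : Level} (F : Field c ℓ) → let open PowerSeries F in
    ∀ (n : ℕ) (Δ : ℕ)
      (M1 M2 M4 : Mat (suc n)) (cs : Fin (suc n) → PS) (t r : Fin (suc n) → ℕ)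
      (M7 : Fin (suc n) → Fin (suc n) → Carrier) (k : Permutation′ (suc n)) (δ : ℕ) →
    -- M1 upper triangular with diagonal [c_1 u^{t_1}, ..., c_d u^{t_d}], c_x units
    (∀ (x : Fin (suc n)) → IsUnit (cs x)) →
    (∀ (x : Fin (suc n)) → M1 x x ≈ₚ cs x *ₚ u^ (t x)) →
    (∀ (z x : Fin (suc n)) → x Fin.< z → M1 z x ≈ₚ 0ₚ) →
    -- 0 ≤ r_1 ≤ ... ≤ r_d ≤ Δ
    (∀ (x y : Fin (suc n)) → x Fin.≤ y → r x ≤ℕ r y) →
    (∀ (x : Fin (suc n)) → r x ≤ℕ Δ) →
    -- M4 ∈ GL_d(k_E + u^Δ k_E[[u]])
    InGL Δ M4 →
    -- M1 = M2 M3 M4 with M3 = [u^{r_1}, ..., u^{r_d}]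
    M1 ≈ₘ M2 ⊗ diag (λ x → u^ (r x)) ⊗ M4 →
    -- M7 ∈ GL_d(k_E) unipotent upper triangular
    (∀ (x : Fin (suc n)) → M7 x x ≈ 1#) →
    (∀ (z x : Fin (suc n)) → x Fin.< z → M7 z x ≈ 0#) →
    -- M4 M7 satisfies Property (Z) w.r.t. Δ and k
    PropertyZ Δ k (M4 ⊗ constM M7) →
    -- gap condition with δ > 0
    0 <ℕ δ →
    (∀ (x : Fin n) → r (Fin.inject₁ x) +ℕ δ ≤ℕ r (Fin.suc x)) →
    r (Fin.fromℕ n) +ℕ δ ≤ℕ Δ →
    ∃ λ Q → InGL δ Q ×
      (diag (λ x → u^ (r x)) ⊗ M4 ⊗ constM M7 ≈ₘ Q ⊗ diag (λ x → u^ (r (k ⟨$⟩ʳ x))))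
lemma3p1p3 F n Δ M1 M2 M4 cs t r M7 k δ _ _ _ r-mono _ _ _ _ _ N-pivoted 0<δ gaps last-gap =
  Q , Q∈GL , D_r-N≈Q-D_b
  where
  open PowerSeries F
  open PowerSeriesProperties F
  open PivotConjugation F r k 0<δ (consecutiveGaps⇒gaps r r-mono gaps) (lastGap⇒gaps r r-mono last-gap)
                        N-pivoted

  D_r-N≈Q-D_b : diag (λ x → u^ (r x)) ⊗ M4 ⊗ constM M7 ≈ₘ Q ⊗ diag (λ x → u^ (r (k ⟨$⟩ʳ x)))
  D_r-N≈Q-D_b i j = ≈ₚ-trans (u^-diag-⊗-⊗ r M4 (constM M7) i j)
                    (≈ₚ-trans (≈ₚ-sym (shift-Q i j)) (≈ₚ-sym (⊗-u^-diag (λ x → r (k ⟨$⟩ʳ x)) Q i j)))
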